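{- Let $(\delta,K_1,K_2,C_0,C_1)$ be admissible, let $M$ be a magic distance, and let $\mathbf C$ be a $K_1$-cycle with edge labels $x_1,\dots,x_k$. Then $x_i<K_1$ and hence $x_i<M$ for every $1\le i\le k$.
   Context: A $\delta$-edge-labelled cycle is a cycle graph (at least 3 vertices) with edge labels in $\{1,\dots,\delta\}$. It is non-metric if some edge label exceeds the sum of all other edge labels, and metric otherwise. A $K_1$-cycle is a metric cycle of odd perimeter (sum of labels) with labels $x_1,\dots,x_k$ such that $\sum x_i<2K_1$. Parameters: integers with $3\le\delta<\infty$, $1\le K_1\le K_2\le\delta$, $2\delta+2\le C_0,C_1\le3\delta+2$, $C_0$ even, $C_1$ odd; $C=\min(C_0,C_1)$, $C'=\max(C_0,C_1)$. Admissible means either Case II: $C\le2\delta+K_1$, $C=2K_1+2K_2+1$, $K_1+K_2\ge\delta$, $K_1+2K_2\le2\delta-1$, and either $C'=C+1$ or ($C'>C+1$, $K_1=K_2$, $3K_2=2\delta-1$); or Case III: $C>2\delta+K_1$, $K_1+2K_2\ge2\delta-1$, $3K_2\ge2\delta$, if $K_1+2K_2=2\delta-1$ then $C\ge2\delta+K_1+2$, if $C'>C+1$ then $C\ge2\delta+K_2$. Magic distance: $M\in\{1,\dots,\delta\}$ with $\max(K_1,\lceil\delta/2\rceil)\le M\le\min(K_2,\lfloor(C-\delta-1)/2\rfloor)$, such that moreover $M>K_1$ if Case III holds with $K_1+2K_2=2\delta-1$, and $M<K_2$ if Case III holds with $C'>C+1$ and $C=2\delta+K_2$. -}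

module Defs where

open import Data.Nat using (ℕ; _+_; _*_; _∸_; _≤_; _<_; _⊔_; _⊓_; ⌊_/2⌋; ⌈_/2⌉)
open import Data.Nat.DivMod using (_%_)
open import Data.List using (List; length)
open import Data.Nat.ListAction using (sum)
open import Data.List.Relation.Unary.All using (All)
open import Data.Product using (_×_)
open import Data.Sum using (_⊎_)
open import Relation.Binary.PropositionalEquality using (_≡_)

Even : ℕ → Set
Even n = n % 2 ≡ 0

Odd : ℕ → Set
Odd n = n % 2 ≡ 1

-- A δ-edge-labelled cycle: the list of its edge labels x₁,…,x_k
-- (in cyclic order), with k ≥ 3 and each label in {1,…,δ}.
record LabelledCycle (δ : ℕ) : Set where
  constructor cycle
  field
    labels    : List ℕ
    length≥3  : 3 ≤ length labels
    inRange   : All (λ x → 1 ≤ x × x ≤ δ) labels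
open LabelledCycle public

perimeter : ∀ {δ} → LabelledCycle δ → ℕ
perimeter c = sum (labels c)

-- Metric: no edge label exceeds the sum of all other labels,
-- i.e. for each label x, x ≤ perimeter − x.
Metric : ∀ {δ} → LabelledCycle δ → Set
Metric c = All (λ x → x ≤ perimeter c ∸ x) (labels c)

IsK1Cycle : ∀ {δ} → ℕ → LabelledCycle δ → Set
IsK1Cycle K₁ c = Metric c × Odd (perimeter c) × perimeter c < 2 * K₁

Params : ℕ → ℕ → ℕ → ℕ → ℕ → Set
Params δ K₁ K₂ C₀ C₁ =
  3 ≤ δ × 1 ≤ K₁ × K₁ ≤ K₂ × K₂ ≤ δ ×
  2 * δ + 2 ≤ C₀ × C₀ ≤ 3 * δ + 2 ×
  2 * δ + 2 ≤ C₁ × C₁ ≤ 3 * δ + 2 ×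
  Even C₀ × Odd C₁

module _ (δ K₁ K₂ C₀ C₁ : ℕ) where
  private
    C  = C₀ ⊓ C₁
    C' = C₀ ⊔ C₁

  CaseII : Set
  CaseII =
    C ≤ 2 * δ + K₁ × C ≡ 2 * K₁ + 2 * K₂ + 1 × δ ≤ K₁ + K₂ ×
    K₁ + 2 * K₂ ≤ 2 * δ ∸ 1 ×
    (C' ≡ C + 1 ⊎ (C + 1 < C' × K₁ ≡ K₂ × 3 * K₂ ≡ 2 * δ ∸ 1))

  CaseIII : Set
  CaseIII =
    2 * δ + K₁ < C × 2 * δ ∸ 1 ≤ K₁ + 2 * K₂ × 2 * δ ≤ 3 * K₂ ×
    (K₁ + 2 * K₂ ≡ 2 * δ ∸ 1 → 2 * δ + K₁ + 2 ≤ C) ×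
    (C + 1 < C' → 2 * δ + K₂ ≤ C)

  Admissible : Set
  Admissible = Params δ K₁ K₂ C₀ C₁ × (CaseII ⊎ CaseIII)

  MagicDistance : ℕ → Set
  MagicDistance M =
    1 ≤ M × M ≤ δ ×
    K₁ ⊔ ⌈ δ /2⌉ ≤ M × M ≤ K₂ ⊓ ⌊ (C ∸ δ ∸ 1) /2⌋ ×
    (CaseIII → K₁ + 2 * K₂ ≡ 2 * δ ∸ 1 → K₁ < M) ×
    (CaseIII → C + 1 < C' → C ≡ 2 * δ + K₂ → M < K₂)

module Submission where

open import Defs
open import Data.Nat using (ℕ; _<_; _≤_; _+_; _*_; _∸_; _⊔_)
open import Data.Nat.Properties
open import Data.Product using (_×_; _,_)
open import Data.List.Relation.Unary.All using (All)
import Data.List.Relation.Unary.All as All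
open import Relation.Binary.PropositionalEquality using (cong)

double≤-of-≤∸ : ∀ {x p} → x ≤ p ∸ x → 2 * x ≤ p
double≤-of-≤∸ {x} {p} x≤p∸x = begin
  2 * x        ≡⟨ cong (x +_) (+-identityʳ x) ⟩
  x + x        ≤⟨ +-monoʳ-≤ x x≤p∸x ⟩
  x + (p ∸ x)  ≡⟨ m+[n∸m]≡n (≤-trans x≤p∸x (m∸n≤m p x)) ⟩
  p            ∎
  where open ≤-Reasoning

metric-label<half : ∀ {x p K} → x ≤ p ∸ x → p < 2 * K → x < K
metric-label<half x≤p∸x p<2K = *-cancelˡ-< 2 _ _ (≤-<-trans (double≤-of-≤∸ x≤p∸x) p<2K)

mainTheorem4 : (δ K₁ K₂ C₀ C₁ M : ℕ) → Admissible δ K₁ K₂ C₀ C₁ →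
    MagicDistance δ K₁ K₂ C₀ C₁ M →
    (c : LabelledCycle δ) → IsK1Cycle K₁ c →
    All (λ x → x < K₁ × x < M) (labels c)
mainTheorem4 δ K₁ K₂ C₀ C₁ M _ (_ , _ , K₁⊔⌈δ/2⌉≤M , _) c (metric , _ , p<2K₁) =
  All.map below-K₁-and-M metric
  where
  K₁≤M : K₁ ≤ M
  K₁≤M = ≤-trans (m≤m⊔n K₁ _) K₁⊔⌈δ/2⌉≤M

  below-K₁-and-M : ∀ {x : ℕ} → x ≤ perimeter c ∸ x → x < K₁ × x < M
  below-K₁-and-M {x} x≤p∸x = x<K₁ , <-≤-trans x<K₁ K₁≤M
    where
    x<K₁ : x < K₁
    x<K₁ = metric-label<half x≤p∸x p<2K₁
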